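{- Let $V$ be a finite set, $A$ a real symmetric matrix indexed by $V$, and $S\subseteq V$ a proper strongly homogeneous set for $A$. Then $A$ is Robinsonian if and only if both $A[S]$ and $A/S$ are Robinsonian. Moreover: (i) if $\sigma_1=(x_1,\dots,x_p)$ is a Robinson ordering of $A[S]$ and $\sigma_2=(y_1,\dots,y_{j-1},s,y_j,\dots,y_q)$ is a Robinson ordering of $A/S$ (where $s\in S$ is the element representing $S$ in $A/S$), then $\sigma=(y_1,\dots,y_{j-1},x_1,\dots,x_p,y_j,\dots,y_q)$ is a Robinson ordering of $A$; (ii) any weighted asteroidal triple of $A[S]$ or of $A/S$ is a weighted asteroidal triple of $A$.
   Context: A triple $(x,y,z)$ of distinct elements is Robinson for a symmetric matrix $B$ if $B_{xz}\le\min\{B_{xy},B_{yz}\}$. A linear order $\pi$ of the index set is a Robinson ordering of $B$ if every triple $(x,y,z)$ with $x\prec_\pi y\prec_\pi z$ is Robinson; $B$ is Robinsonian if it has a Robinson ordering. A set $S\subseteq V$ is strongly homogeneous for $A$ if $A_{xy}=A_{xz}\le A_{yz}$ for all $x\in V\setminus S$ and all distinct $y,z\in S$; it is proper if $2\le |S|\le |V|-1$. $A[S]$ denotes the principal submatrix of $A$ indexed by $S$, and $A/S$ denotes the principal submatrix $A[(V\setminus S)\cup\{s\}]$ for an arbitrary fixed $s\in S$. For $z$ in the index set, a path avoiding $z$ in $B$ is a sequence $(v_0,\dots,v_k)$ ($k\ge0$) of distinct indices different from $z$ such that $B_{v_{i-1}v_i}>\min\{B_{v_{i-1}z},B_{v_iz}\}$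 for $1\le i\le k$; write $x\overset{z}{\sim}y$ if there is such a path from $x$ to $y$. A set $\{x,y,z\}$ of three distinct indices is a weighted asteroidal triple of $B$ if $x\overset{z}{\sim}y$, $y\overset{x}{\sim}z$, $z\overset{y}{\sim}x$ in $B$. -}

module Defs where

open import Level using (Level; _⊔_; 0ℓ)
open import Data.Nat using (ℕ; _<_; _≤_; _∸_)
open import Data.Fin using (Fin)
open import Data.Fin.Subset using (Subset; _∈_; _∉_; ∣_∣)
open import Data.List using (List; []; _∷_; length; lookup; head; last)
open import Data.List.Relation.Unary.All using (All)
open import Data.List.Relation.Unary.Linked using (Linked)
open import Data.List.Relation.Unary.Unique.Propositional using (Unique)
import Data.List.Membership.Propositional as LM
open import Data.Maybe using (just)
open import Data.Product using (_×_; ∃; Σ)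
open import Data.Sum using (_⊎_)
open import Data.Unit using (⊤)
open import Function.Bundles using (_⇔_)
open import Relation.Nullary using (¬_)
open import Relation.Unary using (Pred)
open import Relation.Binary.Bundles using (TotalOrder)
open import Relation.Binary.PropositionalEquality using (_≡_; _≢_)
import Data.Fin as F

-- Index sets are subsets of V = Fin n, given as predicates.
-- A matrix restricted to an index set U is the principal submatrix A[U].

Full : ∀ {n} → Pred (Fin n) 0ℓ
Full _ = ⊤

InSet : ∀ {n} → Subset n → Pred (Fin n) 0ℓ
InSet S v = v ∈ S

-- index set of A/S = A[(V \ S) ∪ {s}]
QuotSet : ∀ {n} → Subset n → Fin n → Pred (Fin n) 0ℓ
QuotSet S s v = v ∉ S ⊎ v ≡ s

Proper : ∀ {n} → Subset n → Set
Proper {n} S = 2 ≤ ∣ S ∣ × ∣ S ∣ ≤ n ∸ 1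

IsLinearOrder : ∀ {n} → Pred (Fin n) 0ℓ → List (Fin n) → Set
IsLinearOrder U π = Unique π × (∀ v → (v LM.∈ π) ⇔ U v)

module _ {c ℓ₁ ℓ₂} (O : TotalOrder c ℓ₁ ℓ₂) where
  open TotalOrder O using (Carrier; _≈_) renaming (_≤_ to _≤ᵒ_)

  _<ᵒ_ : Carrier → Carrier → Set (ℓ₁ ⊔ ℓ₂)
  a <ᵒ b = a ≤ᵒ b × ¬ (a ≈ b)

  Matrix : ℕ → Set c
  Matrix n = Fin n → Fin n → Carrier

  SymmetricMatrix : ∀ {n} → Matrix n → Set ℓ₁
  SymmetricMatrix A = ∀ x y → A x y ≈ A y x

  RobinsonTriple : ∀ {n} → Matrix n → Fin n → Fin n → Fin n → Set ℓ₂
  RobinsonTriple B x y z = B x z ≤ᵒ B x y × B x z ≤ᵒ B y z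

  RobinsonOrdering : ∀ {n} → Matrix n → Pred (Fin n) 0ℓ → List (Fin n) → Set ℓ₂
  RobinsonOrdering B U π =
    IsLinearOrder U π ×
    (∀ (i j k : Fin (length π)) → i F.< j → j F.< k →
       RobinsonTriple B (lookup π i) (lookup π j) (lookup π k))

  Robinsonian : ∀ {n} → Matrix n → Pred (Fin n) 0ℓ → Set ℓ₂
  Robinsonian B U = ∃ λ π → RobinsonOrdering B U π

  StronglyHomogeneous : ∀ {n} → Matrix n → Subset n → Set (ℓ₁ ⊔ ℓ₂)
  StronglyHomogeneous A S =
    ∀ x y z → x ∉ S → y ∈ S → z ∈ S → y ≢ z → A x y ≈ A x z × A x y ≤ᵒ A y z

  AvoidStep : ∀ {n} → Matrix n → Fin n → Fin n → Fin n → Set (ℓ₁ ⊔ ℓ₂)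
  AvoidStep B z u v = B u z <ᵒ B u v ⊎ B v z <ᵒ B u v

  PathAvoiding : ∀ {n} → Matrix n → Pred (Fin n) 0ℓ → Fin n → List (Fin n) → Set (ℓ₁ ⊔ ℓ₂)
  PathAvoiding B U z vs =
    Unique vs × All (λ v → U v × v ≢ z) vs × Linked (AvoidStep B z) vs

  Connected : ∀ {n} → Matrix n → Pred (Fin n) 0ℓ → Fin n → Fin n → Fin n → Set (ℓ₁ ⊔ ℓ₂)
  Connected B U z x y =
    ∃ λ vs → PathAvoiding B U z vs × head vs ≡ just x × last vs ≡ just y

  WAT : ∀ {n} → Matrix n → Pred (Fin n) 0ℓ → Fin n → Fin n → Fin n → Set (ℓ₁ ⊔ ℓ₂)
  WAT B U x y z =
    (U x × U y × U z) × (x ≢ y × y ≢ z × x ≢ z) ×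
    Connected B U z x y × Connected B U x y z × Connected B U y z x

-- Strong homogeneity says that every x ∉ S sees all of S alike and that A x y ≤ A y z for
-- x ∉ S and y, z ∈ S.  Blow the representative s in a Robinson ordering of A/S up into a
-- Robinson ordering of A[S]: a triple with one point in S has the same entries as the triple
-- of A/S in which that point is replaced by s, a triple with two points in S is Robinson by the
-- inequality above, and a triple inside S is a triple of A[S].  Conversely a Robinson ordering
-- restricts to every principal submatrix, and a path avoiding a point in a principal submatrix
-- is such a path in A itself.
module Submission where

open import Defs
open import Data.Nat using (ℕ; z≤n; s≤s)
open import Data.Fin using (Fin)
open import Data.Fin.Subset using (Subset; _∈_)
open import Data.List using (List; _∷_; _++_)
open import Data.Product using (_×_)
open import Data.Sum using (_⊎_)
open import Function.Bundles using (_⇔_)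
open import Relation.Binary.Bundles using (TotalOrder)

import Data.Fin as F
open import Level using (_⊔_; 0ℓ)
open import Data.Fin using (zero; suc)
open import Data.Fin.Subset using (_∉_)
open import Data.Fin.Subset.Properties using (_∈?_)
open import Data.Fin.Properties using (_≟_)
open import Data.List using ([]; length; lookup; filter)
open import Data.Product using (_,_; proj₁; proj₂; ∃₂)
import Data.Product as Product
open import Data.Sum using (inj₁; inj₂; [_,_])
open import Data.Unit using (tt)
open import Data.Empty using (⊥-elim)
open import Function.Bundles using (mk⇔; Equivalence)
open import Relation.Nullary using (¬_; yes; no; ¬?)
open import Relation.Nullary.Decidable using (_⊎-dec_)
open import Relation.Unary using (Pred; Decidable) renaming (_⊆_ to _⊆ᵤ_)
open import Relation.Binary.PropositionalEquality using (_≡_; _≢_; refl; cong; subst; sym)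
open import Data.List.Relation.Binary.Sublist.Propositional
  using (_⊆_; []; _∷_; _∷ʳ_; ⊆-refl; ⊆-trans; minimum; from∈; to∈)
open import Data.List.Relation.Binary.Sublist.Propositional.Properties
  using (All-resp-⊆; Any-resp-⊆; ++⁺; ++⁺ˡ; ++⁺ʳ; filter-⊆)
open import Data.List.Relation.Binary.Disjoint.Propositional using (Disjoint)
open import Data.List.Membership.Propositional using () renaming (_∈_ to _∈ₗ_)
open import Data.List.Membership.Propositional.Properties
  using (∈-++⁺ˡ; ∈-++⁺ʳ; ∈-++⁻; ∈-∃++; ∈-filter⁺; ∈-filter⁻; ∈-lookup)
open import Data.List.Relation.Unary.Any using (here; there; index)
open import Data.List.Relation.Unary.Any.Properties using (lookup-index)
open import Data.List.Relation.Unary.All using (All; []; _∷_)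
import Data.List.Relation.Unary.All as All
import Data.List.Relation.Unary.All.Properties as All
open import Data.List.Relation.Unary.AllPairs using (AllPairs; []; _∷_)
open import Data.List.Relation.Unary.Unique.Propositional using (Unique)
import Data.List.Relation.Unary.Unique.Propositional.Properties as Unique

module _ {a} {X : Set a} where

  AllPairs-resp-⊇ : ∀ {r} {R : X → X → Set r} {xs ys : List X} →
                    xs ⊆ ys → AllPairs R ys → AllPairs R xs
  AllPairs-resp-⊇ []         []         = []
  AllPairs-resp-⊇ (_ ∷ʳ p)   (_ ∷ rys)  = AllPairs-resp-⊇ p rys
  AllPairs-resp-⊇ (refl ∷ p) (ry ∷ rys) = All-resp-⊆ p ry ∷ AllPairs-resp-⊇ p rys

  Unique⇒≢ : ∀ {π : List X} {x y} → Unique π → (x ∷ y ∷ []) ⊆ π → x ≢ y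
  Unique⇒≢ u p with AllPairs-resp-⊇ p u
  ... | (x≢y ∷ []) ∷ _ = x≢y

  Unique-++⇒Disjoint : ∀ (xs : List X) {ys} → Unique (xs ++ ys) → Disjoint xs ys
  Unique-++⇒Disjoint xs u (v∈xs , v∈ys) = Unique⇒≢ u (++⁺ (from∈ v∈xs) (from∈ v∈ys)) refl

  Unique⇒∉-++ : ∀ (ys : List X) {x zs} → Unique (ys ++ x ∷ zs) → ¬ x ∈ₗ ys ++ zs
  Unique⇒∉-++ ys u x∈ with ∈-++⁻ ys x∈
  ... | inj₁ x∈ys = Unique⇒≢ u (++⁺ (from∈ x∈ys) (refl ∷ minimum _)) refl
  ... | inj₂ x∈zs = Unique⇒≢ u (++⁺ˡ ys (refl ∷ from∈ x∈zs)) refl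

  ⊆-++-split : ∀ (as : List X) {bs xs} → xs ⊆ as ++ bs →
               ∃₂ λ xs₁ xs₂ → xs ≡ xs₁ ++ xs₂ × xs₁ ⊆ as × xs₂ ⊆ bs
  ⊆-++-split []       p          = [] , _ , refl , [] , p
  ⊆-++-split (a ∷ as) (.a ∷ʳ p)  with xs₁ , xs₂ , eq , p₁ , p₂ ← ⊆-++-split as p
    = xs₁ , xs₂ , eq , a ∷ʳ p₁ , p₂
  ⊆-++-split (a ∷ as) (refl ∷ p) with xs₁ , xs₂ , eq , p₁ , p₂ ← ⊆-++-split as p
    = a ∷ xs₁ , xs₂ , cong (a ∷_) eq , refl ∷ p₁ , p₂

  lookup₂-⊆ : ∀ (π : List X) {j k : Fin (length π)} → j F.< k → (lookup π j ∷ lookup π k ∷ []) ⊆ π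
  lookup₂-⊆ (x ∷ π) {zero}  {suc k} _         = refl ∷ from∈ (∈-lookup k)
  lookup₂-⊆ (x ∷ π) {suc j} {suc k} (s≤s j<k) = x ∷ʳ lookup₂-⊆ π j<k

  ⊆-lookup₂ : ∀ (π : List X) {y z : X} → (y ∷ z ∷ []) ⊆ π →
              ∃₂ λ (j k : Fin (length π)) → j F.< k × lookup π j ≡ y × lookup π k ≡ z
  ⊆-lookup₂ (w ∷ π) (.w ∷ʳ p) with j , k , j<k , eqʲ , eqᵏ ← ⊆-lookup₂ π p
    = suc j , suc k , s≤s j<k , eqʲ , eqᵏ
  ⊆-lookup₂ (w ∷ π) (refl ∷ p) =
    zero , suc (index (to∈ p)) , s≤s z≤n , refl , sym (lookup-index (to∈ p))

  -- Defs states the Robinson condition on indices; the proofs work with 3-element sublists.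
  module _ {ℓ} (P : X → X → X → Set ℓ) where

    OrderedTriples : List X → Set (a ⊔ ℓ)
    OrderedTriples π = ∀ x y z → (x ∷ y ∷ z ∷ []) ⊆ π → P x y z

    IndexedTriples : List X → Set ℓ
    IndexedTriples π = ∀ (i j k : Fin (length π)) → i F.< j → j F.< k →
                       P (lookup π i) (lookup π j) (lookup π k)

    ordered⇒indexed : ∀ (π : List X) → OrderedTriples π → IndexedTriples π
    ordered⇒indexed (x ∷ π) h zero    (suc j) (suc k) _         (s≤s j<k) =
      h _ _ _ (refl ∷ lookup₂-⊆ π j<k)
    ordered⇒indexed (x ∷ π) h (suc i) (suc j) (suc k) (s≤s i<j) (s≤s j<k) =
      ordered⇒indexed π (λ u v w p → h u v w (x ∷ʳ p)) i j k i<j j<k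

    indexed⇒ordered : ∀ (π : List X) → IndexedTriples π → OrderedTriples π
    indexed⇒ordered (w ∷ π) h x y z (.w ∷ʳ p) =
      indexed⇒ordered π (λ i j k i<j j<k → h (suc i) (suc j) (suc k) (s≤s i<j) (s≤s j<k)) x y z p
    indexed⇒ordered (w ∷ π) h x y z (refl ∷ p) with j , k , j<k , refl , refl ← ⊆-lookup₂ π p
      = h zero (suc j) (suc k) (s≤s z≤n) (s≤s j<k)

IsLinearOrder⇒All : ∀ {n} {U : Pred (Fin n) 0ℓ} {π} → IsLinearOrder U π → All U π
IsLinearOrder⇒All (_ , members) = All.tabulate λ {v} → Equivalence.to (members v)

module RobinsonOrderings {c ℓ₁ ℓ₂} (O : TotalOrder c ℓ₁ ℓ₂) {n : ℕ} (A : Matrix O n) where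
  open TotalOrder O using (_≈_; ≤-respˡ-≈; ≤-respʳ-≈)

  RobinsonTriple-resp-≈ : ∀ {x y z x′ y′ z′} →
    A x y ≈ A x′ y′ → A x z ≈ A x′ z′ → A y z ≈ A y′ z′ →
    RobinsonTriple O A x y z → RobinsonTriple O A x′ y′ z′
  RobinsonTriple-resp-≈ xy xz yz (xz≤xy , xz≤yz) =
    ≤-respˡ-≈ xz (≤-respʳ-≈ xy xz≤xy) , ≤-respˡ-≈ xz (≤-respʳ-≈ yz xz≤yz)

  filter-RobinsonOrdering : ∀ {U W : Pred (Fin n) 0ℓ} (U? : Decidable U) → U ⊆ᵤ W → ∀ π →
    RobinsonOrdering O A W π → RobinsonOrdering O A U (filter U? π)
  filter-RobinsonOrdering {U} U? U⊆W π ((unique , members) , robinson) =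
    (Unique.filter⁺ U? unique , λ v → mk⇔ (λ v∈ → proj₂ (∈-filter⁻ U? {xs = π} v∈)) (from v)) ,
    ordered⇒indexed (RobinsonTriple O A) _ λ x y z p →
      indexed⇒ordered (RobinsonTriple O A) π robinson x y z (⊆-trans p (filter-⊆ U? π))
    where
    from : ∀ v → U v → v ∈ₗ filter U? π
    from v Uv = ∈-filter⁺ U? (Equivalence.from (members v) (U⊆W Uv)) Uv

  Connected-mono : ∀ {U W : Pred (Fin n) 0ℓ} {z x y} → U ⊆ᵤ W →
                   Connected O A U z x y → Connected O A W z x y
  Connected-mono U⊆W (vs , (unique , inside , steps) , first , last) =
    vs , (unique , All.map (Product.map₁ U⊆W) inside , steps) , first , last

  WAT-mono : ∀ {U W : Pred (Fin n) 0ℓ} {x y z} → U ⊆ᵤ W → WAT O A U x y z → WAT O A W x y z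
  WAT-mono U⊆W ((Ux , Uy , Uz) , distinct , c₁ , c₂ , c₃) =
    (U⊆W Ux , U⊆W Uy , U⊆W Uz) , distinct ,
    Connected-mono U⊆W c₁ , Connected-mono U⊆W c₂ , Connected-mono U⊆W c₃

module StronglyHomogeneousSet {c ℓ₁ ℓ₂} (O : TotalOrder c ℓ₁ ℓ₂) {n : ℕ} {A : Matrix O n}
  (symmetric : SymmetricMatrix O A) {S : Subset n} (homogeneous : StronglyHomogeneous O A S)
  {s : Fin n} (s∈S : s ∈ S) where
  open TotalOrder O using (_≈_; reflexive; ≤-respˡ-≈; module Eq)
  open RobinsonOrderings O A

  private
    R : Fin n → Fin n → Fin n → Set ℓ₂
    R = RobinsonTriple O A

  outside-constantʳ : ∀ {u x y} → u ∉ S → x ∈ S → y ∈ S → A u x ≈ A u y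
  outside-constantʳ {x = x} {y} u∉S x∈S y∈S with x ≟ y
  ... | yes refl = Eq.refl
  ... | no x≢y   = proj₁ (homogeneous _ x y u∉S x∈S y∈S x≢y)

  outside-constantˡ : ∀ {u x y} → u ∉ S → x ∈ S → y ∈ S → A x u ≈ A y u
  outside-constantˡ u∉S x∈S y∈S =
    Eq.trans (symmetric _ _) (Eq.trans (outside-constantʳ u∉S x∈S y∈S) (symmetric _ _))

  robinson-∈∉∉ : ∀ {x y z} → x ∈ S → y ∉ S → z ∉ S → R s y z → R x y z
  robinson-∈∉∉ x∈S y∉S z∉S = RobinsonTriple-resp-≈
    (outside-constantˡ y∉S s∈S x∈S) (outside-constantˡ z∉S s∈S x∈S) Eq.refl

  robinson-∉∈∉ : ∀ {x y z} → x ∉ S → y ∈ S → z ∉ S → R x s z → R x y z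
  robinson-∉∈∉ x∉S y∈S z∉S = RobinsonTriple-resp-≈
    (outside-constantʳ x∉S s∈S y∈S) Eq.refl (outside-constantˡ z∉S s∈S y∈S)

  robinson-∉∉∈ : ∀ {x y z} → x ∉ S → y ∉ S → z ∈ S → R x y s → R x y z
  robinson-∉∉∈ x∉S y∉S z∈S = RobinsonTriple-resp-≈
    Eq.refl (outside-constantʳ x∉S s∈S z∈S) (outside-constantʳ y∉S s∈S z∈S)

  robinson-∈∈∉ : ∀ {x y z} → x ∈ S → y ∈ S → z ∉ S → x ≢ y → R x y z
  robinson-∈∈∉ {x} {y} {z} x∈S y∈S z∉S x≢y with _ , zx≤xy ← homogeneous z x y z∉S x∈S y∈S x≢y
    = ≤-respˡ-≈ (symmetric z x) zx≤xy , reflexive (outside-constantˡ z∉S x∈S y∈S)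

  robinson-∉∈∈ : ∀ {x y z} → x ∉ S → y ∈ S → z ∈ S → y ≢ z → R x y z
  robinson-∉∈∈ {x} {y} {z} x∉S y∈S z∈S y≢z with xy≈xz , xy≤yz ← homogeneous x y z x∉S y∈S z∈S y≢z
    = reflexive (Eq.sym xy≈xz) , ≤-respˡ-≈ xy≈xz xy≤yz

  quotient-ends-outside : ∀ ys zs → IsLinearOrder (QuotSet S s) (ys ++ s ∷ zs) → All (_∉ S) (ys ++ zs)
  quotient-ends-outside ys zs (unique , members) = All.tabulate outside
    where
    outside : ∀ {v} → v ∈ₗ ys ++ zs → v ∉ S
    outside {v} v∈ with Equivalence.to (members v) (Any-resp-⊆ (++⁺ ⊆-refl (s ∷ʳ ⊆-refl)) v∈)
    ... | inj₁ v∉S = v∉S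
    ... | inj₂ refl = ⊥-elim (Unique⇒∉-++ ys unique v∈)

  substitute-IsLinearOrder : ∀ {σ₁} ys zs → IsLinearOrder (InSet S) σ₁ →
    IsLinearOrder (QuotSet S s) (ys ++ s ∷ zs) → IsLinearOrder Full (ys ++ σ₁ ++ zs)
  substitute-IsLinearOrder {σ₁} ys zs (unique₁ , members₁) order₂@(unique₂ , members₂) =
    Unique.++⁺ (AllPairs-resp-⊇ (++⁺ʳ (s ∷ zs) ⊆-refl) unique₂)
               (Unique.++⁺ unique₁ (AllPairs-resp-⊇ (++⁺ˡ ys (s ∷ʳ ⊆-refl)) unique₂) σ₁-zs-disjoint)
               ys-disjoint ,
    λ v → mk⇔ (λ _ → tt) (λ _ → every v)
    where
    outside : All (_∉ S) (ys ++ zs)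
    outside = quotient-ends-outside ys zs order₂
    inside : ∀ {v} → v ∈ₗ σ₁ → v ∈ S
    inside {v} = Equivalence.to (members₁ v)
    σ₁-zs-disjoint : Disjoint σ₁ zs
    σ₁-zs-disjoint (v∈σ₁ , v∈zs) = All.lookup outside (∈-++⁺ʳ ys v∈zs) (inside v∈σ₁)
    ys-disjoint : Disjoint ys (σ₁ ++ zs)
    ys-disjoint (v∈ys , v∈σ₁zs) with ∈-++⁻ σ₁ v∈σ₁zs
    ... | inj₁ v∈σ₁ = All.lookup outside (∈-++⁺ˡ v∈ys) (inside v∈σ₁)
    ... | inj₂ v∈zs = Unique-++⇒Disjoint ys unique₂ (v∈ys , there v∈zs)
    every : ∀ v → v ∈ₗ ys ++ σ₁ ++ zs
    every v with v ∈? S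
    ... | yes v∈S = ∈-++⁺ʳ ys (∈-++⁺ˡ (Equivalence.from (members₁ v) v∈S))
    ... | no v∉S with ∈-++⁻ ys (Equivalence.from (members₂ v) (inj₁ v∉S))
    ...   | inj₁ v∈ys         = ∈-++⁺ˡ v∈ys
    ...   | inj₂ (here refl)  = ⊥-elim (v∉S s∈S)
    ...   | inj₂ (there v∈zs) = ∈-++⁺ʳ ys (∈-++⁺ʳ σ₁ v∈zs)

  substitute-OrderedTriples : ∀ {σ₁} ys zs → Unique σ₁ → All (_∈ S) σ₁ → All (_∉ S) (ys ++ zs) →
    OrderedTriples R σ₁ → OrderedTriples R (ys ++ s ∷ zs) → OrderedTriples R (ys ++ σ₁ ++ zs)
  substitute-OrderedTriples {σ₁} ys zs unique₁ inside outside robinson₁ robinson₂ x y z p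
    with l₁ , l₂₃ , eq₁ , p₁ , p₂₃ ← ⊆-++-split ys p
    with l₂ , l₃ , eq₂₃ , p₂ , p₃ ← ⊆-++-split σ₁ p₂₃
    = pieces l₁ l₂ l₃ (All-resp-⊆ p₁ (All.++⁻ˡ ys outside)) (All-resp-⊆ p₂ inside)
        (All-resp-⊆ p₃ (All.++⁻ʳ ys outside)) p₁ p₂ p₃ (subst (λ l → _ ≡ l₁ ++ l) eq₂₃ eq₁)
    where
    pieces : ∀ {x y z} l₁ l₂ l₃ → All (_∉ S) l₁ → All (_∈ S) l₂ → All (_∉ S) l₃ →
             l₁ ⊆ ys → l₂ ⊆ σ₁ → l₃ ⊆ zs → x ∷ y ∷ z ∷ [] ≡ l₁ ++ l₂ ++ l₃ → R x y z
    pieces _ [] _ _ _ _ p₁ _ p₃ eq =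
      robinson₂ _ _ _ (subst (_⊆ ys ++ s ∷ zs) (sym eq) (++⁺ p₁ (s ∷ʳ p₃)))
    pieces [] (_ ∷ []) _ _ (x∈S ∷ []) (y∉S ∷ z∉S ∷ []) p₁ _ p₃ refl =
      robinson-∈∉∉ x∈S y∉S z∉S (robinson₂ _ _ _ (++⁺ p₁ (refl ∷ p₃)))
    pieces [] (_ ∷ _ ∷ []) _ _ (x∈S ∷ y∈S ∷ []) (z∉S ∷ []) _ p₂ _ refl =
      robinson-∈∈∉ x∈S y∈S z∉S (Unique⇒≢ unique₁ p₂)
    pieces [] (_ ∷ _ ∷ _ ∷ []) _ _ _ _ _ p₂ _ refl = robinson₁ _ _ _ p₂
    pieces [] (_ ∷ _ ∷ _ ∷ _ ∷ _) _ _ _ _ _ _ _ ()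
    pieces (_ ∷ []) (_ ∷ []) _ (x∉S ∷ []) (y∈S ∷ []) (z∉S ∷ []) p₁ _ p₃ refl =
      robinson-∉∈∉ x∉S y∈S z∉S (robinson₂ _ _ _ (++⁺ p₁ (refl ∷ p₃)))
    pieces (_ ∷ []) (_ ∷ _ ∷ []) _ (x∉S ∷ []) (y∈S ∷ z∈S ∷ []) _ _ p₂ _ refl =
      robinson-∉∈∈ x∉S y∈S z∈S (Unique⇒≢ unique₁ p₂)
    pieces (_ ∷ []) (_ ∷ _ ∷ _ ∷ _) _ _ _ _ _ _ _ ()
    pieces (_ ∷ _ ∷ []) (_ ∷ []) _ (x∉S ∷ y∉S ∷ []) (z∈S ∷ []) _ p₁ _ p₃ refl =
      robinson-∉∉∈ x∉S y∉S z∈S (robinson₂ _ _ _ (++⁺ p₁ (refl ∷ p₃)))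
    pieces (_ ∷ _ ∷ []) (_ ∷ _ ∷ _) _ _ _ _ _ _ _ ()
    pieces (_ ∷ _ ∷ _ ∷ []) (_ ∷ _) _ _ _ _ _ _ _ ()
    pieces (_ ∷ _ ∷ _ ∷ _ ∷ _) (_ ∷ _) _ _ _ _ _ _ _ ()

  substitute-RobinsonOrdering : ∀ σ₁ ys zs → RobinsonOrdering O A (InSet S) σ₁ →
    RobinsonOrdering O A (QuotSet S s) (ys ++ s ∷ zs) → RobinsonOrdering O A Full (ys ++ σ₁ ++ zs)
  substitute-RobinsonOrdering σ₁ ys zs (order₁ , robinson₁) (order₂ , robinson₂) =
    substitute-IsLinearOrder ys zs order₁ order₂ ,
    ordered⇒indexed R _ (substitute-OrderedTriples ys zs (proj₁ order₁) (IsLinearOrder⇒All order₁)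
      (quotient-ends-outside ys zs order₂)
      (indexed⇒ordered R σ₁ robinson₁) (indexed⇒ordered R _ robinson₂))

lemma2p2 : ∀ {c ℓ₁ ℓ₂} (O : TotalOrder c ℓ₁ ℓ₂) (n : ℕ) (A : Matrix O n) →
  SymmetricMatrix O A → (S : Subset n) → Proper S → StronglyHomogeneous O A S →
  (s : Fin n) → s ∈ S →
  (Robinsonian O A Full ⇔ (Robinsonian O A (InSet S) × Robinsonian O A (QuotSet S s)))
  × (∀ (σ₁ ys zs : List (Fin n)) →
       RobinsonOrdering O A (InSet S) σ₁ →
       RobinsonOrdering O A (QuotSet S s) (ys ++ s ∷ zs) →
       RobinsonOrdering O A Full (ys ++ σ₁ ++ zs))
  × (∀ (x y z : Fin n) →
       (WAT O A (InSet S) x y z ⊎ WAT O A (QuotSet S s) x y z) →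
       WAT O A Full x y z)
lemma2p2 O n A symmetric S _ homogeneous s s∈S =
  mk⇔ restrict extend , substitute-RobinsonOrdering ,
  λ _ _ _ → [ WAT-mono (λ _ → tt) , WAT-mono (λ _ → tt) ]
  where
  open RobinsonOrderings O A
  open StronglyHomogeneousSet O symmetric homogeneous s∈S

  restrict : Robinsonian O A Full → Robinsonian O A (InSet S) × Robinsonian O A (QuotSet S s)
  restrict (π , ρ) =
    (_ , filter-RobinsonOrdering (_∈? S) (λ _ → tt) π ρ) ,
    (_ , filter-RobinsonOrdering (λ v → ¬? (v ∈? S) ⊎-dec (v ≟ s)) (λ _ → tt) π ρ)

  extend : Robinsonian O A (InSet S) × Robinsonian O A (QuotSet S s) → Robinsonian O A Full
  extend ((σ₁ , ρ₁) , (π , ρ₂))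
    with ys , zs , refl ← ∈-∃++ (Equivalence.from (proj₂ (proj₁ ρ₂) s) (inj₂ refl))
    = ys ++ σ₁ ++ zs , substitute-RobinsonOrdering σ₁ ys zs ρ₁ ρ₂
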